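{- For every integer $n\geq 0$, let $$ r_n=\sum_{j=1}^{n+1}\sum_{h=-1}^{n-j}\frac{(-1)^{n+j+h}}{j}\, b_h\,\frac{1}{(n-h-j)!\,j!}. $$ Then $$ r_n=\sum_{h=-1}^{n-1} b_h\,\frac{(-1)^{n-h+1}}{(n-h)!}\,H_{n-h}. $$
   Context: The numbers $b_k$, $k\geq -1$, are defined by $\frac{1}{1-e^{ -t}}=\sum_{k=-1}^{+\infty}b_k t^k$ (so $b_k=(-1)^{k+1}\frac{B_{k+1}}{(k+1)!}$ with $B_j$ the Bernoulli numbers). $H_m=1+\frac12+\cdots+\frac1m$ is the $m$-th harmonic number. -}

module Defs where

open import Data.Nat using (ℕ; zero; suc; _∸_; _!)
open import Data.Nat.Properties using (_!≢0)
open import Data.Integer using (+_)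
open import Data.Rational using (ℚ; 0ℚ; 1ℚ; _+_; _*_; -_; _/_)
open import Relation.Binary.PropositionalEquality using (_≡_)

∑ : ℕ → (ℕ → ℚ) → ℚ
∑ zero    f = 0ℚ
∑ (suc n) f = ∑ n f + f n

sgn : ℕ → ℚ
sgn zero    = 1ℚ
sgn (suc k) = - sgn k

invFact : ℕ → ℚ
invFact m = (+ 1 / (m !)) {{m !≢0}}

invSuc : ℕ → ℚ
invSuc k = + 1 / suc k

H : ℕ → ℚ
H m = ∑ m invSuc

δ₀ : ℕ → ℚ
δ₀ zero    = 1ℚ
δ₀ (suc _) = 0ℚ

-- The sequence b_k (k ≥ -1) is encoded with shifted index: c i = b_(i-1), i ≥ 0.
-- "1/(1-e^{-t}) = Σ_{k≥-1} b_k t^k" means (1 - e^{-t}) · Σ_{k≥-1} b_k t^k = 1,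
-- with 1 - e^{-t} = Σ_{m≥1} (-1)^{m+1} t^m / m!.  Comparing the coefficient of t^N
-- (N ≥ 0):  Σ_{m=1}^{N+1} (-1)^{m+1}/m! · b_{N-m} = [N = 0].
-- With m = l+1 and b_{N-m} = c (N ∸ l):
IsBernoulliB : (ℕ → ℚ) → Set
IsBernoulliB c = ∀ N → ∑ (suc N) (λ l → sgn l * invFact (suc l) * c (N ∸ l)) ≡ δ₀ N

{-# OPTIONS --safe #-}
module Submission where

-- After exchanging the two sums over the triangle k + i ≤ n, the coefficient of b_(i-1) is, with
-- m = n - i, equal to (-1)^m Σ_k (-1)^k / ((k+1) (k+1)! (m-k)!).  Multiplied by (m+1)! this sum becomes
-- S_N = Σ_k (-1)^k C(N,k+1) / (k+1) with N = m+1, and S_N = H_N: by Pascal's rule and the absorption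
-- identity C(N,k) / (k+1) = C(N+1,k+1) / (N+1),  S_(N+1) - S_N = Σ_k (-1)^k C(N+1,k+1) / (N+1) = 1/(N+1).

open import Data.Rational.Base using (0ℚ)
open import Data.Rational.Properties using (_≟_; +-*-commutativeRing)
open import Level using (0ℓ)
open import Relation.Nullary.Decidable using (dec⇒maybe)
open import Tactic.RingSolver.Core.AlmostCommutativeRing using (AlmostCommutativeRing; fromCommutativeRing)

ℚ-ring : AlmostCommutativeRing 0ℓ 0ℓ
ℚ-ring = fromCommutativeRing +-*-commutativeRing (λ x → dec⇒maybe (0ℚ ≟ x))

module FiniteSums where

  open import Data.Bool.Base using (if_then_else_)
  open import Data.Nat.Base as ℕ using (ℕ; zero; suc; _∸_; _≤_; _<_; s≤s⁻¹)
  open import Data.Nat.Properties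
    using ( _≤?_; +-comm; m<n⇒m<1+n; n<1+n; m≤n⇒m<n∨m≡n; <⇒≱; m∸n≤m
          ; m≤o∸n⇒m+n≤o; m+n≤o⇒m≤o∸n)
  open import Data.Rational.Base using (ℚ; _+_; _*_; -_)
  open import Data.Rational.Properties as ℚ
    using (+-identityʳ; +-assoc; *-zeroʳ; *-distribˡ-+; neg-distrib-+)
  open import Data.Sum.Base using (inj₁; inj₂)
  open import Relation.Binary.PropositionalEquality
  open import Relation.Nullary.Decidable using (does; dec-true; dec-false)
  open import Relation.Nullary.Negation using (¬_)
  open import Relation.Unary using (Pred; Decidable)
  open import Tactic.RingSolver using (solve-∀)
  open import Defs using (∑)
  open ≡-Reasoning

  ∑-cong : ∀ n {f g : ℕ → ℚ} → (∀ k → k < n → f k ≡ g k) → ∑ n f ≡ ∑ n g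
  ∑-cong zero    f≡g = refl
  ∑-cong (suc n) f≡g = cong₂ _+_ (∑-cong n (λ k k<n → f≡g k (m<n⇒m<1+n k<n))) (f≡g n (n<1+n n))

  ∑-zero : ∀ n → ∑ n (λ _ → 0ℚ) ≡ 0ℚ
  ∑-zero zero    = refl
  ∑-zero (suc n) = cong (_+ 0ℚ) (∑-zero n)

  ∑-distrib-+ : ∀ n (f g : ℕ → ℚ) → ∑ n (λ k → f k + g k) ≡ ∑ n f + ∑ n g
  ∑-distrib-+ zero    f g = refl
  ∑-distrib-+ (suc n) f g =
    trans (cong (_+ (f n + g n)) (∑-distrib-+ n f g)) (interchange (∑ n f) (∑ n g) (f n) (g n))
    where
    interchange : ∀ a b c d → (a + b) + (c + d) ≡ (a + c) + (b + d)
    interchange = solve-∀ ℚ-ring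

  *-distribˡ-∑ : ∀ n a (f : ℕ → ℚ) → a * ∑ n f ≡ ∑ n (λ k → a * f k)
  *-distribˡ-∑ zero    a f = *-zeroʳ a
  *-distribˡ-∑ (suc n) a f =
    trans (*-distribˡ-+ a (∑ n f) (f n)) (cong (_+ a * f n) (*-distribˡ-∑ n a f))

  neg-distrib-∑ : ∀ n (f : ℕ → ℚ) → - ∑ n f ≡ ∑ n (λ k → - f k)
  neg-distrib-∑ zero    f = refl
  neg-distrib-∑ (suc n) f = trans (neg-distrib-+ (∑ n f) (f n)) (cong (_+ - f n) (neg-distrib-∑ n f))

  ∑-head : ∀ n (f : ℕ → ℚ) → ∑ (suc n) f ≡ f 0 + ∑ n (λ k → f (suc k))
  ∑-head zero    f = ℚ.+-comm 0ℚ (f 0)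
  ∑-head (suc n) f = trans (cong (_+ f (suc n)) (∑-head n f)) (+-assoc (f 0) _ _)

  ∑-comm : ∀ m n (g : ℕ → ℕ → ℚ) →
           ∑ m (λ k → ∑ n (g k)) ≡ ∑ n (λ i → ∑ m (λ k → g k i))
  ∑-comm zero    n g = sym (∑-zero n)
  ∑-comm (suc m) n g = trans (cong (_+ ∑ n (g m)) (∑-comm m n g)) (sym (∑-distrib-+ n _ (g m)))

  ∑-extend : ∀ {m n} (f : ℕ → ℚ) → m ≤ n →
             (∀ i → m ≤ i → i < n → f i ≡ 0ℚ) → ∑ m f ≡ ∑ n f
  ∑-extend {n = zero}  f ℕ.z≤n _ = refl
  ∑-extend {m} {suc n} f m≤1+n vanish with m≤n⇒m<n∨m≡n m≤1+n
  ... | inj₂ refl  = refl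
  ... | inj₁ m<1+n = begin
    ∑ m f          ≡⟨ ∑-extend f m≤n (λ i m≤i i<n → vanish i m≤i (m<n⇒m<1+n i<n)) ⟩
    ∑ n f          ≡⟨ +-identityʳ (∑ n f) ⟨
    ∑ n f + 0ℚ     ≡⟨ cong (∑ n f +_) (vanish n m≤n (n<1+n n)) ⟨
    ∑ (suc n) f    ∎
    where
    m≤n : m ≤ n
    m≤n = s≤s⁻¹ m<1+n

  ∑-restrict : ∀ {p m n} {P : Pred ℕ p} (P? : Decidable P) (f : ℕ → ℚ) → m ≤ n →
               (∀ i → i < m → P i) → (∀ i → m ≤ i → ¬ P i) →
               ∑ m f ≡ ∑ n (λ i → if does (P? i) then f i else 0ℚ)
  ∑-restrict {m = m} {n} P? f m≤n inside outside = begin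
    ∑ m f   ≡⟨ ∑-cong m (λ i i<m → cong (if_then f i else 0ℚ) (dec-true (P? i) (inside i i<m))) ⟨
    ∑ m f′  ≡⟨ ∑-extend f′ m≤n (λ i m≤i _ → dropped i m≤i) ⟩
    ∑ n f′  ∎
    where
    f′ : ℕ → ℚ
    f′ i = if does (P? i) then f i else 0ℚ
    dropped : ∀ i → m ≤ i → f′ i ≡ 0ℚ
    dropped i m≤i = cong (if_then f i else 0ℚ) (dec-false (P? i) (outside i m≤i))

  ∑-triangle-swap : ∀ n (g : ℕ → ℕ → ℚ) →
    ∑ (suc n) (λ k → ∑ (suc (n ∸ k)) (g k)) ≡ ∑ (suc n) (λ i → ∑ (suc (n ∸ i)) (λ k → g k i))
  ∑-triangle-swap n g = begin
    ∑ (suc n) (λ k → ∑ (suc (n ∸ k)) (g k))         ≡⟨ ∑-cong (suc n) row ⟩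
    ∑ (suc n) (λ k → ∑ (suc n) (λ i → g′ k i))      ≡⟨ ∑-comm (suc n) (suc n) g′ ⟩
    ∑ (suc n) (λ i → ∑ (suc n) (λ k → g′ k i))      ≡⟨ ∑-cong (suc n) column ⟨
    ∑ (suc n) (λ i → ∑ (suc (n ∸ i)) (λ k → g k i)) ∎
    where
    g′ : ℕ → ℕ → ℚ
    g′ k i = if does (k ℕ.+ i ≤? n) then g k i else 0ℚ

    row : ∀ k → k < suc n → ∑ (suc (n ∸ k)) (g k) ≡ ∑ (suc n) (g′ k)
    row k k<1+n = ∑-restrict (λ i → k ℕ.+ i ≤? n) (g k) (ℕ.s≤s (m∸n≤m n k))
      (λ i i<1+n∸k → subst (_≤ n) (+-comm i k) (m≤o∸n⇒m+n≤o i (s≤s⁻¹ k<1+n) (s≤s⁻¹ i<1+n∸k)))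
      (λ i n∸k<i k+i≤n → <⇒≱ n∸k<i (m+n≤o⇒m≤o∸n i (subst (_≤ n) (+-comm k i) k+i≤n)))

    column : ∀ i → i < suc n → ∑ (suc (n ∸ i)) (λ k → g k i) ≡ ∑ (suc n) (λ k → g′ k i)
    column i i<1+n = ∑-restrict (λ k → k ℕ.+ i ≤? n) (λ k → g k i) (ℕ.s≤s (m∸n≤m n i))
      (λ k k<1+n∸i → m≤o∸n⇒m+n≤o k (s≤s⁻¹ i<1+n) (s≤s⁻¹ k<1+n∸i))
      (λ k n∸i<k k+i≤n → <⇒≱ n∸i<k (m+n≤o⇒m≤o∸n k k+i≤n))

module BinomialSums where

  open import Data.Integer.Base as ℤ using (+_)
  import Data.Integer.Properties as ℤ
  open import Data.Nat.Base as ℕ using (ℕ; zero; suc; _∸_; _!; _≤_; s≤s; s≤s⁻¹; NonZero)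
  open import Data.Nat.Combinatorics using (_C_; nCk+nC[k+1]≡[n+1]C[k+1]; k![n∸k]!∣n!)
  open import Data.Nat.Combinatorics.Specification using (nCk≡n!/k![n-k]!; k>n⇒nCk≡0)
  open import Data.Nat.Coprimality using (1-coprimeTo)
  open import Data.Nat.DivMod using (m/n*n≡m)
  open import Data.Nat.Properties
    using (_≤?_; n<1+n; ≰⇒>; *-comm; *-cancelʳ-≡; m*n≢0; _!≢0; _!*_!≢0)
  open import Data.Nat.Tactic.RingSolver using () renaming (ring to ℕ-ring)
  open import Data.Rational.Base using (ℚ; 1ℚ; _+_; _*_; -_; _/_)
  open import Data.Rational.Literals using (fromℤ)
  open import Data.Rational.Properties
    using ( toℚᵘ-injective; toℚᵘ-homo-+; toℚᵘ-homo-*; normalize-coprime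
          ; *-inverseˡ; *-identityʳ; *-distribˡ-+; neg-distribˡ-*)
  import Data.Rational.Unnormalised.Base as ℚᵘ
  import Data.Rational.Unnormalised.Properties as ℚᵘ
  open import Relation.Binary.PropositionalEquality
  open import Relation.Nullary.Decidable using (yes; no)
  open import Tactic.RingSolver using (solve-∀)
  open import Defs using (∑; sgn; invSuc; invFact; H)
  open FiniteSums
  open ≡-Reasoning

  fromℕ : ℕ → ℚ
  fromℕ n = fromℤ (+ n)

  fromℕ-+ : ∀ m n → fromℕ (m ℕ.+ n) ≡ fromℕ m + fromℕ n
  fromℕ-+ m n = toℚᵘ-injective
    (ℚᵘ.≃-trans (ℚᵘ.*≡* numerators) (ℚᵘ.≃-sym (toℚᵘ-homo-+ (fromℕ m) (fromℕ n))))
    where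
    numerators : + (m ℕ.+ n) ℤ.* + 1 ≡ (+ m ℤ.* + 1 ℤ.+ + n ℤ.* + 1) ℤ.* + 1
    numerators = cong (ℤ._* + 1)
      (trans (ℤ.pos-+ m n) (sym (cong₂ ℤ._+_ (ℤ.*-identityʳ (+ m)) (ℤ.*-identityʳ (+ n)))))

  fromℕ-* : ∀ m n → fromℕ (m ℕ.* n) ≡ fromℕ m * fromℕ n
  fromℕ-* m n = toℚᵘ-injective
    (ℚᵘ.≃-trans (ℚᵘ.*≡* numerators) (ℚᵘ.≃-sym (toℚᵘ-homo-* (fromℕ m) (fromℕ n))))
    where
    numerators : + (m ℕ.* n) ℤ.* + 1 ≡ (+ m ℤ.* + n) ℤ.* + 1
    numerators = cong (ℤ._* + 1) (ℤ.pos-* m n)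

  1/n*n≡1 : ∀ n .{{_ : NonZero n}} → (+ 1 / n) * fromℕ n ≡ 1ℚ
  1/n*n≡1 (suc n) = trans (cong (_* fromℕ (suc n)) (normalize-coprime (1-coprimeTo (suc n))))
                          (*-inverseˡ (fromℕ (suc n)))

  *-cancelʳ-fromℕ : ∀ n .{{_ : NonZero n}} {x y} → x * fromℕ n ≡ y * fromℕ n → x ≡ y
  *-cancelʳ-fromℕ n {x} {y} eq = begin
    x                                ≡⟨ *-identityʳ x ⟨
    x * 1ℚ                           ≡⟨ cong (x *_) (1/n*n≡1 n) ⟨
    x * ((+ 1 / n) * fromℕ n)        ≡⟨ regroup x (+ 1 / n) (fromℕ n) ⟩
    (x * fromℕ n) * (+ 1 / n)        ≡⟨ cong (_* (+ 1 / n)) eq ⟩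
    (y * fromℕ n) * (+ 1 / n)        ≡⟨ regroup y (+ 1 / n) (fromℕ n) ⟨
    y * ((+ 1 / n) * fromℕ n)        ≡⟨ cong (y *_) (1/n*n≡1 n) ⟩
    y * 1ℚ                           ≡⟨ *-identityʳ y ⟩
    y                                ∎
    where
    regroup : ∀ a b c → a * (b * c) ≡ (a * c) * b
    regroup = solve-∀ ℚ-ring

  cross-multiplication : ∀ p q .{{_ : NonZero p}} .{{_ : NonZero q}} {x y} →
                         x * fromℕ q ≡ y * fromℕ p → x * (+ 1 / p) ≡ y * (+ 1 / q)
  cross-multiplication p q {x} {y} xq≡yp = *-cancelʳ-fromℕ (p ℕ.* q) {{m*n≢0 p q}} (begin
    x * (+ 1 / p) * fromℕ (p ℕ.* q)          ≡⟨ cong (x * (+ 1 / p) *_) (fromℕ-* p q) ⟩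
    x * (+ 1 / p) * (fromℕ p * fromℕ q)      ≡⟨ regroupˡ x (+ 1 / p) (fromℕ p) (fromℕ q) ⟩
    (x * fromℕ q) * ((+ 1 / p) * fromℕ p)    ≡⟨ cong₂ _*_ xq≡yp (1/n*n≡1 p) ⟩
    (y * fromℕ p) * 1ℚ                       ≡⟨ cong ((y * fromℕ p) *_) (1/n*n≡1 q) ⟨
    (y * fromℕ p) * ((+ 1 / q) * fromℕ q)    ≡⟨ regroupʳ y (+ 1 / q) (fromℕ p) (fromℕ q) ⟩
    y * (+ 1 / q) * (fromℕ p * fromℕ q)      ≡⟨ cong (y * (+ 1 / q) *_) (fromℕ-* p q) ⟨
    y * (+ 1 / q) * fromℕ (p ℕ.* q)          ∎)
    where
    regroupˡ : ∀ a b c d → a * b * (c * d) ≡ (a * d) * (b * c)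
    regroupˡ = solve-∀ ℚ-ring
    regroupʳ : ∀ a b c d → (a * c) * (b * d) ≡ a * b * (c * d)
    regroupʳ = solve-∀ ℚ-ring

  nCk*k![n∸k]!≡n! : ∀ {n k} → k ≤ n → (n C k) ℕ.* (k ! ℕ.* (n ∸ k) !) ≡ n !
  nCk*k![n∸k]!≡n! {n} {k} k≤n =
    trans (cong (ℕ._* (k ! ℕ.* (n ∸ k) !)) (nCk≡n!/k![n-k]! k≤n)) (m/n*n≡m (k![n∸k]!∣n! k≤n))
    where instance _ = k !* (n ∸ k) !≢0

  nCk*[n+1]≡[n+1]C[k+1]*[k+1] : ∀ n k → (n C k) ℕ.* suc n ≡ (suc n C suc k) ℕ.* suc k
  nCk*[n+1]≡[n+1]C[k+1]*[k+1] n k with k ≤? n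
  ... | no k≰n = trans (cong (ℕ._* suc n) (k>n⇒nCk≡0 (≰⇒> k≰n)))
                       (sym (cong (ℕ._* suc k) (k>n⇒nCk≡0 (s≤s (≰⇒> k≰n)))))
  ... | yes k≤n = *-cancelʳ-≡ _ _ d (begin
    (n C k) ℕ.* suc n ℕ.* d                              ≡⟨ swap (n C k) (suc n) d ⟩
    (n C k) ℕ.* d ℕ.* suc n                              ≡⟨ cong (ℕ._* suc n) (nCk*k![n∸k]!≡n! k≤n) ⟩
    n ! ℕ.* suc n                                        ≡⟨ *-comm (n !) (suc n) ⟩
    suc n !                                              ≡⟨ nCk*k![n∸k]!≡n! (s≤s k≤n) ⟨
    (suc n C suc k) ℕ.* (suc k ℕ.* k ! ℕ.* (n ∸ k) !)    ≡⟨ regroup (suc n C suc k) (suc k) (k !) _ ⟩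
    (suc n C suc k) ℕ.* suc k ℕ.* d                      ∎)
    where
    d : ℕ
    d = k ! ℕ.* (n ∸ k) !
    instance _ = k !* (n ∸ k) !≢0
    swap : ∀ a b c → a ℕ.* b ℕ.* c ≡ a ℕ.* c ℕ.* b
    swap = solve-∀ ℕ-ring
    regroup : ∀ a b c d → a ℕ.* (b ℕ.* c ℕ.* d) ≡ a ℕ.* b ℕ.* (c ℕ.* d)
    regroup = solve-∀ ℕ-ring

  fromℕ-pascal : ∀ n k → fromℕ (suc n C suc k) ≡ fromℕ (n C k) + fromℕ (n C suc k)
  fromℕ-pascal n k =
    trans (cong fromℕ (sym (nCk+nC[k+1]≡[n+1]C[k+1] n k))) (fromℕ-+ (n C k) (n C suc k))

  fromℕ-nC[n+1]≡0 : ∀ n → fromℕ (n C suc n) ≡ 0ℚ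
  fromℕ-nC[n+1]≡0 n = cong fromℕ (k>n⇒nCk≡0 (n<1+n n))

  nCk/[k+1]≡[n+1]C[k+1]/[n+1] : ∀ n k → fromℕ (n C k) * invSuc k ≡ fromℕ (suc n C suc k) * invSuc n
  nCk/[k+1]≡[n+1]C[k+1]/[n+1] n k = cross-multiplication (suc k) (suc n) (begin
    fromℕ (n C k) * fromℕ (suc n)               ≡⟨ fromℕ-* (n C k) (suc n) ⟨
    fromℕ ((n C k) ℕ.* suc n)                   ≡⟨ cong fromℕ (nCk*[n+1]≡[n+1]C[k+1]*[k+1] n k) ⟩
    fromℕ ((suc n C suc k) ℕ.* suc k)           ≡⟨ fromℕ-* (suc n C suc k) (suc k) ⟩
    fromℕ (suc n C suc k) * fromℕ (suc k)       ∎)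

  1/[n∸k]!*1/[k+1]!≡[n+1]C[k+1]/[n+1]! : ∀ {n k} → k ≤ n →
    invFact (n ∸ k) * invFact (suc k) ≡ fromℕ (suc n C suc k) * invFact (suc n)
  1/[n∸k]!*1/[k+1]!≡[n+1]C[k+1]/[n+1]! {n} {k} k≤n =
    cross-multiplication (suc k !) (suc n !) {{suc k !≢0}} {{suc n !≢0}} {x} {fromℕ c} (begin
      x * fromℕ (suc n !)                      ≡⟨ cong (λ j → x * fromℕ j) [n+1]! ⟨
      x * fromℕ (c ℕ.* (a ℕ.* b))              ≡⟨ cong (x *_) fromℕ-*³ ⟩
      x * (fromℕ c * (fromℕ a * fromℕ b))      ≡⟨ regroup x (fromℕ c) (fromℕ a) (fromℕ b) ⟩
      fromℕ c * fromℕ a * (x * fromℕ b)        ≡⟨ cong (fromℕ c * fromℕ a *_) (1/n*n≡1 b) ⟩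
      fromℕ c * fromℕ a * 1ℚ                   ≡⟨ *-identityʳ _ ⟩
      fromℕ c * fromℕ a                        ∎)
    where
    x : ℚ
    x = invFact (n ∸ k)
    c a b : ℕ
    c = suc n C suc k
    a = suc k !
    b = (n ∸ k) !
    instance _ = (n ∸ k) !≢0
    [n+1]! : c ℕ.* (a ℕ.* b) ≡ suc n !
    [n+1]! = nCk*k![n∸k]!≡n! (s≤s k≤n)
    fromℕ-*³ : fromℕ (c ℕ.* (a ℕ.* b)) ≡ fromℕ c * (fromℕ a * fromℕ b)
    fromℕ-*³ = trans (fromℕ-* c (a ℕ.* b)) (cong (fromℕ c *_) (fromℕ-* a b))
    regroup : ∀ x y z w → x * (y * (z * w)) ≡ y * z * (x * w)
    regroup = solve-∀ ℚ-ring

  ∑-alternating-binomial : ∀ n → ∑ (suc n) (λ k → sgn k * fromℕ (suc n C suc k)) ≡ 1ℚ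
  ∑-alternating-binomial n = begin
    ∑ (suc n) (λ k → sgn k * fromℕ (suc n C suc k))
      ≡⟨ ∑-cong (suc n) (λ k _ →
           trans (cong (sgn k *_) (fromℕ-pascal n k)) (*-distribˡ-+ (sgn k) _ _)) ⟩
    ∑ (suc n) (λ k → sgn k * fromℕ (n C k) + sgn k * fromℕ (n C suc k))
      ≡⟨ ∑-distrib-+ (suc n) _ _ ⟩
    ∑ (suc n) (λ k → sgn k * fromℕ (n C k)) + (A + sgn n * fromℕ (n C suc n))
      ≡⟨ cong₂ (λ S c → S + (A + sgn n * c)) (∑-head n _) (fromℕ-nC[n+1]≡0 n) ⟩
    -- the k = 0 term sgn 0 * fromℕ (n C 0) computes to 1ℚ
    (1ℚ + ∑ n (λ k → sgn (suc k) * fromℕ (n C suc k))) + (A + sgn n * 0ℚ)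
      ≡⟨ cong (λ S → (1ℚ + S) + (A + sgn n * 0ℚ)) shifted ⟩
    (1ℚ + - A) + (A + sgn n * 0ℚ)
      ≡⟨ cancel A (sgn n) ⟩
    1ℚ ∎
    where
    A : ℚ
    A = ∑ n (λ k → sgn k * fromℕ (n C suc k))
    shifted : ∑ n (λ k → sgn (suc k) * fromℕ (n C suc k)) ≡ - A
    shifted = trans (∑-cong n (λ k _ → sym (neg-distribˡ-* (sgn k) _))) (sym (neg-distrib-∑ n _))
    cancel : ∀ a s → (1ℚ + - a) + (a + s * 0ℚ) ≡ 1ℚ
    cancel = solve-∀ ℚ-ring

  ∑-alternating-binomial-harmonic : ∀ n → ∑ n (λ k → sgn k * fromℕ (n C suc k) * invSuc k) ≡ H n
  ∑-alternating-binomial-harmonic zero    = refl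
  ∑-alternating-binomial-harmonic (suc n) = begin
    ∑ (suc n) (λ k → sgn k * fromℕ (suc n C suc k) * invSuc k)
      ≡⟨ ∑-cong (suc n) (λ k _ → split k) ⟩
    ∑ (suc n) (λ k → invSuc n * (sgn k * fromℕ (suc n C suc k)) + sgn k * fromℕ (n C suc k) * invSuc k)
      ≡⟨ ∑-distrib-+ (suc n) _ _ ⟩
    ∑ (suc n) (λ k → invSuc n * (sgn k * fromℕ (suc n C suc k))) + (S + last)
      ≡⟨ cong₂ (λ T U → T + (U + last)) alternating (∑-alternating-binomial-harmonic n) ⟩
    invSuc n * 1ℚ + (H n + sgn n * fromℕ (n C suc n) * invSuc n)
      ≡⟨ cong (λ c → invSuc n * 1ℚ + (H n + sgn n * c * invSuc n)) (fromℕ-nC[n+1]≡0 n) ⟩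
    invSuc n * 1ℚ + (H n + sgn n * 0ℚ * invSuc n)
      ≡⟨ simplify (invSuc n) (H n) (sgn n) ⟩
    H n + invSuc n ∎
    where
    S last : ℚ
    S    = ∑ n (λ k → sgn k * fromℕ (n C suc k) * invSuc k)
    last = sgn n * fromℕ (n C suc n) * invSuc n
    distrib : ∀ s a b w → s * (a + b) * w ≡ s * (a * w) + s * b * w
    distrib = solve-∀ ℚ-ring
    reorder : ∀ s c w → s * (c * w) ≡ w * (s * c)
    reorder = solve-∀ ℚ-ring
    simplify : ∀ w h s → w * 1ℚ + (h + s * 0ℚ * w) ≡ h + w
    simplify = solve-∀ ℚ-ring
    split : ∀ k → sgn k * fromℕ (suc n C suc k) * invSuc k
                  ≡ invSuc n * (sgn k * fromℕ (suc n C suc k)) + sgn k * fromℕ (n C suc k) * invSuc k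
    split k = begin
      sgn k * fromℕ (suc n C suc k) * invSuc k
        ≡⟨ cong (λ c → sgn k * c * invSuc k) (fromℕ-pascal n k) ⟩
      sgn k * (fromℕ (n C k) + fromℕ (n C suc k)) * invSuc k
        ≡⟨ distrib (sgn k) (fromℕ (n C k)) (fromℕ (n C suc k)) (invSuc k) ⟩
      sgn k * (fromℕ (n C k) * invSuc k) + rest
        ≡⟨ cong (λ t → sgn k * t + rest) (nCk/[k+1]≡[n+1]C[k+1]/[n+1] n k) ⟩
      sgn k * (fromℕ (suc n C suc k) * invSuc n) + rest
        ≡⟨ cong (_+ rest) (reorder (sgn k) (fromℕ (suc n C suc k)) (invSuc n)) ⟩
      invSuc n * (sgn k * fromℕ (suc n C suc k)) + rest ∎
      where
      rest : ℚ
      rest = sgn k * fromℕ (n C suc k) * invSuc k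
    alternating : ∑ (suc n) (λ k → invSuc n * (sgn k * fromℕ (suc n C suc k))) ≡ invSuc n * 1ℚ
    alternating = trans (sym (*-distribˡ-∑ (suc n) (invSuc n) _))
                        (cong (invSuc n *_) (∑-alternating-binomial n))

  ∑-alternating-factorial-harmonic : ∀ m →
    ∑ (suc m) (λ k → sgn k * invSuc k * (invFact (m ∸ k) * invFact (suc k)))
    ≡ invFact (suc m) * H (suc m)
  ∑-alternating-factorial-harmonic m = begin
    ∑ (suc m) (λ k → sgn k * invSuc k * (invFact (m ∸ k) * invFact (suc k)))
      ≡⟨ ∑-cong (suc m) (λ k k<1+m → term k (s≤s⁻¹ k<1+m)) ⟩
    ∑ (suc m) (λ k → invFact (suc m) * (sgn k * fromℕ (suc m C suc k) * invSuc k))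
      ≡⟨ *-distribˡ-∑ (suc m) (invFact (suc m)) _ ⟨
    invFact (suc m) * ∑ (suc m) (λ k → sgn k * fromℕ (suc m C suc k) * invSuc k)
      ≡⟨ cong (invFact (suc m) *_) (∑-alternating-binomial-harmonic (suc m)) ⟩
    invFact (suc m) * H (suc m) ∎
    where
    reorder : ∀ s w c f → s * w * (c * f) ≡ f * (s * c * w)
    reorder = solve-∀ ℚ-ring
    term : ∀ k → k ≤ m → sgn k * invSuc k * (invFact (m ∸ k) * invFact (suc k))
                         ≡ invFact (suc m) * (sgn k * fromℕ (suc m C suc k) * invSuc k)
    term k k≤m = trans (cong (sgn k * invSuc k *_) (1/[n∸k]!*1/[k+1]!≡[n+1]C[k+1]/[n+1]! k≤m))
                       (reorder (sgn k) (invSuc k) (fromℕ (suc m C suc k)) (invFact (suc m)))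

open import Defs
open import Data.Nat using (ℕ; suc; _+_; _∸_)
open import Data.Rational using (ℚ; _*_)
open import Relation.Binary.PropositionalEquality using (_≡_)

open import Data.Nat.Base using (zero; _≤_; s≤s⁻¹)
open import Data.Nat.Properties using (+-suc; +-comm; ∸-+-assoc; +-∸-assoc; m∸n+n≡m)
open import Data.Nat.Tactic.RingSolver using () renaming (ring to ℕ-ring)
open import Data.Rational.Base using (1ℚ; -_)
open import Data.Rational.Properties using (*-identityˡ; *-identityʳ; neg-distribˡ-*)
open import Relation.Binary.PropositionalEquality using (refl; sym; trans; cong; cong₂; module ≡-Reasoning)
open import Tactic.RingSolver using (solve-∀)
open FiniteSums using (∑-cong; *-distribˡ-∑; ∑-triangle-swap)
open BinomialSums using (∑-alternating-factorial-harmonic)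
open ≡-Reasoning

sgn-+ : ∀ a b → sgn (a + b) ≡ sgn a * sgn b
sgn-+ zero    b = sym (*-identityˡ (sgn b))
sgn-+ (suc a) b = trans (cong -_ (sgn-+ a b)) (neg-distribˡ-* (sgn a) (sgn b))

sgn[i+i]≡1 : ∀ i → sgn (i + i) ≡ 1ℚ
sgn[i+i]≡1 zero    = refl
sgn[i+i]≡1 (suc i) = begin
  - sgn (i + suc i)     ≡⟨ cong (λ j → - sgn j) (+-suc i i) ⟩
  - - sgn (i + i)       ≡⟨ neg-involutive (sgn (i + i)) ⟩
  sgn (i + i)           ≡⟨ sgn[i+i]≡1 i ⟩
  1ℚ                    ∎
  where
  neg-involutive : ∀ x → - - x ≡ x
  neg-involutive = solve-∀ ℚ-ring

sgn[n+k+i]≡sgn[n∸i]*sgn[k] : ∀ {n i} k → i ≤ n → sgn (n + k + i) ≡ sgn (n ∸ i) * sgn k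
sgn[n+k+i]≡sgn[n∸i]*sgn[k] {n} {i} k i≤n = begin
  sgn (n + k + i)                       ≡⟨ cong (λ j → sgn (j + k + i)) (m∸n+n≡m i≤n) ⟨
  sgn (n ∸ i + i + k + i)               ≡⟨ cong sgn (regroup (n ∸ i) i k) ⟩
  sgn ((n ∸ i + k) + (i + i))           ≡⟨ sgn-+ (n ∸ i + k) (i + i) ⟩
  sgn (n ∸ i + k) * sgn (i + i)         ≡⟨ cong (sgn (n ∸ i + k) *_) (sgn[i+i]≡1 i) ⟩
  sgn (n ∸ i + k) * 1ℚ                  ≡⟨ *-identityʳ _ ⟩
  sgn (n ∸ i + k)                       ≡⟨ sgn-+ (n ∸ i) k ⟩
  sgn (n ∸ i) * sgn k                   ∎
  where
  regroup : ∀ a i k → a + i + k + i ≡ (a + k) + (i + i)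
  regroup = solve-∀ ℕ-ring

column-identity : ∀ (c : ℕ → ℚ) n i → i ≤ n →
  ∑ (suc (n ∸ i)) (λ k → sgn (n + k + i) * invSuc k * c i * (invFact (n ∸ k ∸ i) * invFact (suc k)))
  ≡ c i * (sgn (suc (suc n ∸ i)) * invFact (suc n ∸ i)) * H (suc n ∸ i)
column-identity c n i i≤n = begin
  ∑ (suc m) (λ k → sgn (n + k + i) * invSuc k * c i * (invFact (n ∸ k ∸ i) * invFact (suc k)))
    ≡⟨ ∑-cong (suc m) (λ k _ → term k) ⟩
  ∑ (suc m) (λ k → c i * sgn m * (sgn k * invSuc k * (invFact (m ∸ k) * invFact (suc k))))
    ≡⟨ *-distribˡ-∑ (suc m) (c i * sgn m) _ ⟨
  c i * sgn m * ∑ (suc m) (λ k → sgn k * invSuc k * (invFact (m ∸ k) * invFact (suc k)))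
    ≡⟨ cong (c i * sgn m *_) (∑-alternating-factorial-harmonic m) ⟩
  c i * sgn m * (invFact (suc m) * H (suc m))
    ≡⟨ regroup (c i) (sgn m) (invFact (suc m)) (H (suc m)) ⟩
  c i * (sgn (suc (suc m)) * invFact (suc m)) * H (suc m)
    ≡⟨ cong (λ j → c i * (sgn (suc j) * invFact j) * H j) (+-∸-assoc 1 i≤n) ⟨
  c i * (sgn (suc (suc n ∸ i)) * invFact (suc n ∸ i)) * H (suc n ∸ i) ∎
  where
  m : ℕ
  m = n ∸ i
  regroup : ∀ x s f h → x * s * (f * h) ≡ x * (- - s * f) * h
  regroup = solve-∀ ℚ-ring
  rearrange : ∀ s t w x f g → s * t * w * x * (f * g) ≡ x * s * (t * w * (f * g))
  rearrange = solve-∀ ℚ-ring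
  n∸k∸i≡m∸k : ∀ k → n ∸ k ∸ i ≡ m ∸ k
  n∸k∸i≡m∸k k =
    trans (∸-+-assoc n k i) (trans (cong (n ∸_) (+-comm k i)) (sym (∸-+-assoc n i k)))
  term : ∀ k → sgn (n + k + i) * invSuc k * c i * (invFact (n ∸ k ∸ i) * invFact (suc k))
               ≡ c i * sgn m * (sgn k * invSuc k * (invFact (m ∸ k) * invFact (suc k)))
  term k = begin
    sgn (n + k + i) * invSuc k * c i * (invFact (n ∸ k ∸ i) * invFact (suc k))
      ≡⟨ cong₂ (λ s j → s * invSuc k * c i * (invFact j * invFact (suc k)))
               (sgn[n+k+i]≡sgn[n∸i]*sgn[k] k i≤n) (n∸k∸i≡m∸k k) ⟩
    sgn m * sgn k * invSuc k * c i * (invFact (m ∸ k) * invFact (suc k))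
      ≡⟨ rearrange (sgn m) (sgn k) (invSuc k) (c i) (invFact (m ∸ k)) (invFact (suc k)) ⟩
    c i * sgn m * (sgn k * invSuc k * (invFact (m ∸ k) * invFact (suc k))) ∎

mainTheorem3 : (c : ℕ → ℚ) → IsBernoulliB c → (n : ℕ) →
    ∑ (suc n) (λ k → ∑ (suc (n ∸ k)) (λ i →
        sgn (n + k + i) * invSuc k * c i * (invFact (n ∸ k ∸ i) * invFact (suc k))))
    ≡ ∑ (suc n) (λ i → c i * (sgn (suc (suc n ∸ i)) * invFact (suc n ∸ i)) * H (suc n ∸ i))
mainTheorem3 c _ n = begin
  ∑ (suc n) (λ k → ∑ (suc (n ∸ k)) (λ i → summand k i))
    ≡⟨ ∑-triangle-swap n summand ⟩
  ∑ (suc n) (λ i → ∑ (suc (n ∸ i)) (λ k → summand k i))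
    ≡⟨ ∑-cong (suc n) (λ i i<1+n → column-identity c n i (s≤s⁻¹ i<1+n)) ⟩
  ∑ (suc n) (λ i → c i * (sgn (suc (suc n ∸ i)) * invFact (suc n ∸ i)) * H (suc n ∸ i)) ∎
  where
  summand : ℕ → ℕ → ℚ
  summand k i = sgn (n + k + i) * invSuc k * c i * (invFact (n ∸ k ∸ i) * invFact (suc k))
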